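{- For all integers $n\ge 1$ and $k\ge 1$, the number of divisions of a honeycomb strip of length $n$ into exactly $k$ pieces is $$d_k(n)=\binom{n+k-2}{n-k}.$$ The number $s_k(n)$ of divisions of the honeycomb strip of length $n$ into exactly $k$ pieces such that the two last hexagons $n-1$ and $n$ belong to different pieces is $0$ if $n=1$, and for $n\ge 2$ it equals $$s_k(n)=\binom{n+k-3}{n-k}.$$ (Here $\binom{a}{b}=0$ when $b<0$.)
   Context: A honeycomb strip of length $n$ consists of $n$ hexagons labelled $1,\dots,n$ in which hexagon $i$ is adjacent exactly with hexagons $i\pm1$ and $i\pm2$ (when these exist); equivalently its inner dual is the graph $P_n^2$ on vertices $1,\dots,n$ with $i\sim j$ iff $1\le|i-j|\le2$. A division into $k$ pieces is a partition of the hexagons into $k$ blocks each inducing a connected subgraph of $P_n^2$. -}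

module Defs where

open import Data.Nat using (ℕ; zero; suc; _+_; _∸_; _≤_; _≤ᵇ_)
open import Data.Nat.Combinatorics using (_C_)
open import Data.Bool using (Bool; true; false; if_then_else_)
open import Data.Fin using (Fin; toℕ)
open import Data.Vec using (Vec; lookup)
open import Data.Product using (Σ; ∃; _×_; _,_)
open import Data.Sum using (_⊎_)
open import Function.Definitions using (Surjective)
open import Relation.Nullary using (¬_)
open import Relation.Binary.PropositionalEquality using (_≡_)

-- Hexagons are 0-based: hexagon i (1 ≤ i ≤ n) of the paper is the element of Fin n with toℕ = i - 1.

-- Adjacency in the inner dual P_n^2 : i ~ j iff 1 ≤ |i - j| ≤ 2.
Adj : {n : ℕ} → Fin n → Fin n → Set
Adj i j = (toℕ i ≡ toℕ j + 1) ⊎ (toℕ i ≡ toℕ j + 2) ⊎ (toℕ j ≡ toℕ i + 1) ⊎ (toℕ j ≡ toℕ i + 2)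

-- A relation on the hexagons, stored as a Boolean matrix (so that two relations
-- are equal iff they are equal as data; no function extensionality needed).
Rel : ℕ → Set
Rel n = Vec (Vec Bool n) n

_∼[_]_ : {n : ℕ} → Fin n → Rel n → Fin n → Set
i ∼[ R ] j = lookup (lookup R i) j ≡ true

data WalkIn {n : ℕ} (P : Fin n → Set) (i : Fin n) : Fin n → Set where
  here : P i → WalkIn P i i
  step : {j l : Fin n} → WalkIn P i j → Adj j l → P l → WalkIn P i l

-- R is a division of the strip of length n into exactly k pieces:
-- R is an equivalence relation whose classes (the pieces) each induce a connected
-- subgraph of P_n^2, and there are exactly k classes (i.e. the classes are in
-- bijection with Fin k, via a surjective labelling whose fibres are the classes).
record IsDivision (n k : ℕ) (R : Rel n) : Set where
  field
    refl∼  : ∀ i → i ∼[ R ] i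
    sym∼   : ∀ i j → i ∼[ R ] j → j ∼[ R ] i
    trans∼ : ∀ i j l → i ∼[ R ] j → j ∼[ R ] l → i ∼[ R ] l
    connected : ∀ i j → i ∼[ R ] j → WalkIn (λ l → i ∼[ R ] l) i j
    numPieces : Σ (Fin n → Fin k) λ label →
                  Surjective _≡_ _≡_ label ×
                  (∀ i j → (i ∼[ R ] j → label i ≡ label j) × (label i ≡ label j → i ∼[ R ] j))

-- The set of divisions into exactly k pieces (the proof field is irrelevant, so a
-- division is determined by its partition alone).
record Division (n k : ℕ) : Set where
  constructor division
  field
    rel : Rel n
    .isDivision : IsDivision n k rel

-- The last two hexagons n-1 and n (0-based: n-2 and n-1) exist and lie in different pieces.
LastTwoSplit : {n : ℕ} → Rel n → Set
LastTwoSplit {n} R = Σ (Fin n) λ i → Σ (Fin n) λ j →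
  (suc (toℕ i) ≡ toℕ j) × (suc (toℕ j) ≡ n) × ¬ (i ∼[ R ] j)

record SplitDivision (n k : ℕ) : Set where
  constructor splitDivision
  field
    rel : Rel n
    .isDivision : IsDivision n k rel
    .lastTwoSplit : LastTwoSplit rel

binom : ℕ → ℕ → ℕ → ℕ
binom a n k = if k ≤ᵇ n then a C (n ∸ k) else 0

{-# OPTIONS --safe #-}
module Submission where

-- Classify the divisions of the strip of length n + 1 by the piece of the last hexagon. If it
-- contains hexagon n, deleting the last hexagon leaves a division of length n, and each of
-- those arises exactly once, by gluing the new hexagon to the piece of hexagon n; otherwise
-- the division is split. The last hexagon of a split division is either a piece on its own
-- (deleting it leaves a division into one piece fewer) or shares its piece with hexagon n - 1
-- (deleting it leaves a split division of length n). Pieces stay connected after a deletion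
-- because the two neighbours of the last hexagon are adjacent, so walks through it can be
-- shortcut. Hence d_k(n+1) = s_k(n+1) + d_k(n) and s_{k+1}(n+1) = d_k(n) + s_{k+1}(n), and
-- the binomial formulas satisfy the same recurrences by Pascal's rule.

open import Defs
open import Data.Bool using (Bool; true; false)
open import Data.Bool.Properties using (⇔→≡; ¬-not) renaming (_≟_ to _≟ᵇ_)
open import Data.Empty using (⊥; ⊥-elim; ⊥-elim-irr)
open import Data.Fin using (Fin; zero; suc; toℕ; fromℕ; inject₁; punchIn; punchOut)
open import Data.Fin.Properties
  using (toℕ-injective; toℕ-inject₁; toℕ-fromℕ; toℕ<n; fromℕ≢inject₁; +↔⊎;
         punchOut-injective; punchOut-cong; punchOut-punchIn; punchInᵢ≢i)
  renaming (suc-injective to Fin-suc-injective)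
open import Data.Nat using (ℕ; zero; suc; _+_; _∸_; _≤_; s≤s)
open import Data.Nat.Properties
  using (+-comm; +-assoc; +-suc; +-identityʳ; +-cancelʳ-≡; suc-injective; m+1+n≢m; m≤m+n; <⇒≱;
         m∸n≤m; n≤1+n; ≤-trans)
open import Data.Nat.Combinatorics using (_C_; k>n⇒nCk≡0; nCk+nC[k+1]≡[n+1]C[k+1])
open import Data.Product using (Σ; _×_; _,_; proj₁; proj₂)
open import Data.Sum using (_⊎_; inj₁; inj₂)
open import Data.Sum.Function.Propositional using (_⊎-↔_)
open import Data.Vec using ([]; _∷_; lookup; tabulate)
open import Data.Vec.Properties using (lookup∘tabulate; tabulate∘lookup; tabulate-cong; ≡-dec)
open import Function.Bundles using (_↔_; mk↔ₛ′; mk⇔)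
open import Function.Definitions using (Surjective)
open import Function.Properties.Inverse using (↔-trans; ↔-sym)
open import Relation.Nullary using (¬_)
open import Relation.Nullary.Decidable using (recompute)
open import Relation.Binary.PropositionalEquality

entry : ∀ {n} → Rel n → Fin n → Fin n → Bool
entry R i j = lookup (lookup R i) j

fromEntries : ∀ {n} → (Fin n → Fin n → Bool) → Rel n
fromEntries f = tabulate λ i → tabulate (f i)

entry-fromEntries : ∀ {n} (f : Fin n → Fin n → Bool) i j → entry (fromEntries f) i j ≡ f i j
entry-fromEntries f i j =
  trans (cong (λ r → lookup r j) (lookup∘tabulate (λ i → tabulate (f i)) i)) (lookup∘tabulate (f i) j)

fromEntries-entry : ∀ {n} (R : Rel n) → fromEntries (entry R) ≡ R
fromEntries-entry R = trans (tabulate-cong (λ i → tabulate∘lookup (lookup R i))) (tabulate∘lookup R)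

Rel-ext : ∀ {n} {R S : Rel n} → (∀ i j → entry R i j ≡ entry S i j) → R ≡ S
Rel-ext {R = R} {S} h = begin
  R                    ≡⟨ fromEntries-entry R ⟨
  fromEntries (entry R) ≡⟨ tabulate-cong (λ i → tabulate-cong (h i)) ⟩
  fromEntries (entry S) ≡⟨ fromEntries-entry S ⟩
  S                    ∎
  where open ≡-Reasoning

recomputeᵇ : {b c : Bool} → .(b ≡ c) → b ≡ c
recomputeᵇ {b} {c} = recompute (b ≟ᵇ c)

recomputeᴿ : ∀ {n} {R S : Rel n} → .(R ≡ S) → R ≡ S
recomputeᴿ {R = R} {S} = recompute (≡-dec (≡-dec _≟ᵇ_) R S)

false≢true : false ≢ true
false≢true ()

≢true⇒≡false : ∀ {b} → b ≢ true → b ≡ false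
≢true⇒≡false = ¬-not

bool-ext : ∀ {b c} → (b ≡ true → c ≡ true) → (c ≡ true → b ≡ true) → b ≡ c
bool-ext to from = ⇔→≡ (mk⇔ to from)

pullback : ∀ {a b} → (Fin a → Fin b) → Rel b → Rel a
pullback f R = fromEntries λ i j → entry R (f i) (f j)

entry-pullback : ∀ {a b} (f : Fin a → Fin b) R i j → entry (pullback f R) i j ≡ entry R (f i) (f j)
entry-pullback f R = entry-fromEntries (λ i j → entry R (f i) (f j))

pullback⁺ : ∀ {a b} (f : Fin a → Fin b) (R : Rel b) {i j x y} →
            f i ≡ x → f j ≡ y → x ∼[ R ] y → i ∼[ pullback f R ] j
pullback⁺ f R {i} {j} refl refl = trans (entry-pullback f R i j)

pullback⁻ : ∀ {a b} (f : Fin a → Fin b) (R : Rel b) {i j x y} →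
            f i ≡ x → f j ≡ y → i ∼[ pullback f R ] j → x ∼[ R ] y
pullback⁻ f R {i} {j} refl refl = trans (sym (entry-pullback f R i j))

restrict : ∀ {n} → Rel (suc n) → Rel n
restrict = pullback inject₁

AdjN : ℕ → ℕ → Set
AdjN a b = (a ≡ b + 1) ⊎ (a ≡ b + 2) ⊎ (b ≡ a + 1) ⊎ (b ≡ a + 2)

adj-sym : ∀ {n} {i j : Fin n} → Adj i j → Adj j i
adj-sym (inj₁ x) = inj₂ (inj₂ (inj₁ x))
adj-sym (inj₂ (inj₁ x)) = inj₂ (inj₂ (inj₂ x))
adj-sym (inj₂ (inj₂ (inj₁ x))) = inj₁ x
adj-sym (inj₂ (inj₂ (inj₂ x))) = inj₂ (inj₁ x)

adj-irrefl : ∀ {n} (i : Fin n) → ¬ Adj i i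
adj-irrefl i (inj₁ x) = m+1+n≢m (toℕ i) (sym x)
adj-irrefl i (inj₂ (inj₁ x)) = m+1+n≢m (toℕ i) (sym x)
adj-irrefl i (inj₂ (inj₂ (inj₁ x))) = m+1+n≢m (toℕ i) (sym x)
adj-irrefl i (inj₂ (inj₂ (inj₂ x))) = m+1+n≢m (toℕ i) (sym x)

adj-inject₁ : ∀ {n} {i j : Fin n} → Adj i j → Adj (inject₁ i) (inject₁ j)
adj-inject₁ {i = i} {j} = subst₂ AdjN (sym (toℕ-inject₁ i)) (sym (toℕ-inject₁ j))

-- a is adjacent to the hexagon fromℕ n appended when the strip grows from length n to n + 1.
Near : ∀ {n} → Fin n → Set
Near {n} a = (toℕ a + 1 ≡ n) ⊎ (toℕ a + 2 ≡ n)

near-fromℕ : ∀ m → Near (fromℕ m)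
near-fromℕ m = inj₁ (trans (cong (_+ 1) (toℕ-fromℕ m)) (+-comm m 1))

near-inject₁-fromℕ : ∀ m → Near {suc (suc m)} (inject₁ (fromℕ m))
near-inject₁-fromℕ m =
  inj₂ (trans (cong (_+ 2) (trans (toℕ-inject₁ (fromℕ m)) (toℕ-fromℕ m))) (+-comm m 2))

near⇒adj-fromℕ : ∀ {n} {a : Fin n} → Near a → Adj (inject₁ a) (fromℕ n)
near⇒adj-fromℕ {n} {a} near = subst₂ AdjN (sym (toℕ-inject₁ a)) (sym (toℕ-fromℕ n)) (adj near)
  where
  adj : Near a → AdjN (toℕ a) n
  adj (inj₁ p) = inj₂ (inj₂ (inj₁ (sym p)))
  adj (inj₂ p) = inj₂ (inj₂ (inj₂ (sym p)))

adj-fromℕ⇒near : ∀ {n} {a : Fin n} → Adj (inject₁ a) (fromℕ n) → Near a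
adj-fromℕ⇒near {n} {a} adj = near (subst₂ AdjN (toℕ-inject₁ a) (toℕ-fromℕ n) adj)
  where
  below : ∀ {c} → toℕ a ≢ n + c
  below eq = <⇒≱ (toℕ<n a) (subst (n ≤_) (sym eq) (m≤m+n n _))
  near : AdjN (toℕ a) n → Near a
  near (inj₁ x) = ⊥-elim (below x)
  near (inj₂ (inj₁ x)) = ⊥-elim (below x)
  near (inj₂ (inj₂ (inj₁ x))) = inj₁ (sym x)
  near (inj₂ (inj₂ (inj₂ x))) = inj₂ (sym x)

near-near : ∀ {n} {a b : Fin n} → Near a → Near b → a ≡ b ⊎ Adj a b
near-near {a = a} {b} (inj₁ p) (inj₁ q) =
  inj₁ (toℕ-injective (+-cancelʳ-≡ 1 (toℕ a) (toℕ b) (trans p (sym q))))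
near-near {a = a} {b} (inj₂ p) (inj₂ q) =
  inj₁ (toℕ-injective (+-cancelʳ-≡ 2 (toℕ a) (toℕ b) (trans p (sym q))))
near-near {a = a} {b} (inj₁ p) (inj₂ q) =
  inj₂ (inj₁ (+-cancelʳ-≡ 1 (toℕ a) (toℕ b + 1) (trans p (trans (sym q) (sym (+-assoc (toℕ b) 1 1))))))
near-near {a = a} {b} (inj₂ p) (inj₁ q) =
  inj₂ (inj₂ (inj₂ (inj₁
    (+-cancelʳ-≡ 1 (toℕ b) (toℕ a + 1) (trans q (trans (sym p) (sym (+-assoc (toℕ a) 1 1))))))))

near-cases : ∀ {m} {a : Fin (suc (suc m))} → Near a → a ≡ fromℕ (suc m) ⊎ a ≡ inject₁ (fromℕ m)
near-cases {m} {a} (inj₁ p) =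
  inj₁ (toℕ-injective (trans (+-cancelʳ-≡ 1 (toℕ a) (suc m) (trans p (+-comm 1 (suc m))))
                             (sym (toℕ-fromℕ (suc m)))))
near-cases {m} {a} (inj₂ p) =
  inj₂ (toℕ-injective (trans (+-cancelʳ-≡ 2 (toℕ a) m (trans p (+-comm 2 m)))
                             (sym (trans (toℕ-inject₁ (fromℕ m)) (toℕ-fromℕ m)))))

data LastView {n} : Fin (suc n) → Set where
  init : (i : Fin n) → LastView (inject₁ i)
  last : LastView (fromℕ n)

lastView : ∀ {n} (i : Fin (suc n)) → LastView i
lastView {zero} zero = last
lastView {suc n} zero = init zero
lastView {suc n} (suc i) with lastView i
... | init j = init (suc j)
... | last = last

lastView-inject₁ : ∀ {n} (i : Fin n) → lastView (inject₁ i) ≡ init i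
lastView-inject₁ {suc n} zero = refl
lastView-inject₁ {suc n} (suc i) rewrite lastView-inject₁ i = refl

lastView-fromℕ : ∀ n → lastView (fromℕ n) ≡ last
lastView-fromℕ zero = refl
lastView-fromℕ (suc n) rewrite lastView-fromℕ n = refl

collapse : ∀ {n} → Fin n → Fin (suc n) → Fin n
collapse a i with lastView i
... | init j = j
... | last = a

collapse-inject₁ : ∀ {n} (a i : Fin n) → collapse a (inject₁ i) ≡ i
collapse-inject₁ a i rewrite lastView-inject₁ i = refl

collapse-fromℕ : ∀ {n} (a : Fin n) → collapse a (fromℕ n) ≡ a
collapse-fromℕ {n} a rewrite lastView-fromℕ n = refl

walk-end : ∀ {n} {P : Fin n → Set} {i j} → WalkIn P i j → P j
walk-end (here p) = p
walk-end (step w adj p) = p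

walk-cons : ∀ {n} {P : Fin n → Set} {i a j} → P i → Adj i a → WalkIn P a j → WalkIn P i j
walk-cons p adj (here q) = step (here p) adj q
walk-cons p adj (step w adj′ q) = step (walk-cons p adj w) adj′ q

walk-last-step : ∀ {n} {P : Fin n → Set} {i j} → WalkIn P i j → i ≡ j ⊎ Σ (Fin n) λ u → P u × Adj u j
walk-last-step (here p) = inj₁ refl
walk-last-step (step {j} w adj p) = inj₂ (j , walk-end w , adj)

IsWeakHom : ∀ {a b} → (Fin a → Fin b) → Set
IsWeakHom g = ∀ {u v} → Adj u v → g u ≡ g v ⊎ Adj (g u) (g v)

walk-map : ∀ {a b} {P : Fin a → Set} {Q : Fin b → Set} {g : Fin a → Fin b} → IsWeakHom g →
           (∀ {l} → P l → Q (g l)) → ∀ {i j} → WalkIn P i j → WalkIn Q (g i) (g j)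
walk-map hom PQ (here p) = here (PQ p)
walk-map hom PQ (step w adj p) with hom adj
... | inj₁ eq = subst (WalkIn _ _) eq (walk-map hom PQ w)
... | inj₂ adj′ = step (walk-map hom PQ w) adj′ (PQ p)

inject₁-weakHom : ∀ {n} → IsWeakHom (inject₁ {n})
inject₁-weakHom adj = inj₂ (adj-inject₁ adj)

collapse-weakHom : ∀ {n} {a : Fin n} → Near a → IsWeakHom (collapse a)
collapse-weakHom {a = a} near {u} {v} adj = viewed (lastView u) (lastView v) adj
  where
  viewed : ∀ {u v} → LastView u → LastView v → Adj u v →
           collapse a u ≡ collapse a v ⊎ Adj (collapse a u) (collapse a v)
  viewed (init x) (init y) adj rewrite collapse-inject₁ a x | collapse-inject₁ a y =
    inj₂ (subst₂ AdjN (toℕ-inject₁ x) (toℕ-inject₁ y) adj)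
  viewed (init x) last adj rewrite collapse-inject₁ a x | collapse-fromℕ a =
    near-near (adj-fromℕ⇒near adj) near
  viewed last (init y) adj rewrite collapse-inject₁ a y | collapse-fromℕ a
    with near-near (adj-fromℕ⇒near (adj-sym adj)) near
  ... | inj₁ eq = inj₁ (sym eq)
  ... | inj₂ adj′ = inj₂ (adj-sym adj′)
  viewed last last adj = inj₁ refl

Fibres : ∀ {n k} → Rel n → (Fin n → Fin k) → Set
Fibres R label = ∀ i j → (i ∼[ R ] j → label i ≡ label j) × (label i ≡ label j → i ∼[ R ] j)

Labelling : (n k : ℕ) → Rel n → Set
Labelling n k R = Σ (Fin n → Fin k) λ label → Surjective _≡_ _≡_ label × Fibres R label

pullback-fibres : ∀ {a b k} {label : Fin b → Fin k} (f : Fin a → Fin b) (R : Rel b) →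
                  Fibres R label → Fibres (pullback f R) (λ i → label (f i))
pullback-fibres f R fibres i j =
    (λ p → proj₁ (fibres (f i) (f j)) (pullback⁻ f R refl refl p))
  , (λ q → pullback⁺ f R refl refl (proj₂ (fibres (f i) (f j)) q))

pullback-labelling : ∀ {a b k} (f : Fin a → Fin b) (s : Fin b → Fin a) → (∀ x → f (s x) ≡ x) →
                     (R : Rel b) →
                     Labelling b k R → Labelling a k (pullback f R)
pullback-labelling f s f∘s≡id R (label , surjective , fibres) =
  (λ i → label (f i)) , surjective′ , pullback-fibres f R fibres
  where
  surjective′ : Surjective _≡_ _≡_ (λ i → label (f i))
  surjective′ y with surjective y
  ... | x , h = s x , λ { refl → trans (cong label (f∘s≡id x)) (h refl) }

Connected : ∀ {n} → Rel n → Set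
Connected R = ∀ i j → i ∼[ R ] j → WalkIn (λ l → i ∼[ R ] l) i j

pullback-isDivision : ∀ {a b k k′} {R : Rel b} (f : Fin a → Fin b) → IsDivision b k R →
                      Connected (pullback f R) → Labelling a k′ (pullback f R) → IsDivision a k′ (pullback f R)
pullback-isDivision {R = R} f d connected labelling = record
  { refl∼ = λ i → ⁺ (D.refl∼ (f i))
  ; sym∼ = λ i j p → ⁺ (D.sym∼ (f i) (f j) (⁻ p))
  ; trans∼ = λ i j l p q → ⁺ (D.trans∼ (f i) (f j) (f l) (⁻ p) (⁻ q))
  ; connected = connected
  ; numPieces = labelling
  }
  where
  module D = IsDivision d
  ⁺ : ∀ {i j} → f i ∼[ R ] f j → i ∼[ pullback f R ] j
  ⁺ = pullback⁺ f R refl refl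
  ⁻ : ∀ {i j} → i ∼[ pullback f R ] j → f i ∼[ R ] f j
  ⁻ = pullback⁻ f R refl refl

glue : ∀ {n} → Fin n → Rel n → Rel (suc n)
glue a = pullback (collapse a)

glue-isDivision : ∀ {n k} {R : Rel n} {a : Fin n} → IsDivision n k R → Near a → IsDivision (suc n) k (glue a R)
glue-isDivision {n} {k} {R} {a} d near =
  pullback-isDivision (collapse a) d (λ i j → connected (lastView i) (lastView j))
                      (pullback-labelling (collapse a) inject₁ (collapse-inject₁ a) R (IsDivision.numPieces d))
  where
  module D = IsDivision d
  ι = collapse-inject₁ a
  λa = collapse-fromℕ a
  ⁺ = pullback⁺ (collapse a) R
  ⁻ = pullback⁻ (collapse a) R
  adj = near⇒adj-fromℕ near
  glued : ∀ {x l} → x ∼[ R ] l → inject₁ x ∼[ glue a R ] inject₁ l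
  glued = ⁺ (ι _) (ι _)

  connected : ∀ {i j} → LastView i → LastView j → i ∼[ glue a R ] j →
              WalkIn (λ l → i ∼[ glue a R ] l) i j
  connected (init x) (init y) p = walk-map inject₁-weakHom glued (D.connected x y (⁻ (ι x) (ι y) p))
  connected (init x) last p = step (walk-map inject₁-weakHom glued (D.connected x a (⁻ (ι x) λa p))) adj p
  connected last (init y) p =
    walk-cons (⁺ {i = fromℕ n} {j = fromℕ n} λa λa (D.refl∼ a)) (adj-sym adj)
              (walk-map inject₁-weakHom (⁺ λa (ι _)) (D.connected a y (⁻ λa (ι y) p)))
  connected last last p = here p

module _ {n k} {R : Rel (suc n)} (d : IsDivision (suc n) k R) where
  private
    module D = IsDivision d
    label = proj₁ D.numPieces
    surjective = proj₁ (proj₂ D.numPieces)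
    fibres = proj₂ (proj₂ D.numPieces)
    ⁺ = pullback⁺ inject₁ R
    ⁻ = pullback⁻ inject₁ R

  restrict-connected : ∀ {a} → Near a → (∀ x → inject₁ x ∼[ R ] fromℕ n → inject₁ x ∼[ R ] inject₁ a) →
                       Connected (restrict R)
  restrict-connected {a} near H i j p =
    subst₂ (WalkIn _) (collapse-inject₁ a i) (collapse-inject₁ a j)
      (walk-map (collapse-weakHom near) (λ {l} → into (lastView l))
                (D.connected (inject₁ i) (inject₁ j) (⁻ refl refl p)))
    where
    into : ∀ {l} → LastView l → inject₁ i ∼[ R ] l → i ∼[ restrict R ] collapse a l
    into (init y) q = ⁺ refl (cong inject₁ (collapse-inject₁ a y)) q
    into last q = ⁺ refl (cong inject₁ (collapse-fromℕ a)) (H i q)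

  restrict-labelling-joined : ∀ {a} → fromℕ n ∼[ R ] inject₁ a → Labelling n k (restrict R)
  restrict-labelling-joined {a} La =
    (λ i → label (inject₁ i)) , surjective′ , pullback-fibres inject₁ R fibres
    where
    preimage : ∀ {x} → LastView x → Σ (Fin n) λ x′ → label (inject₁ x′) ≡ label x
    preimage (init x) = x , refl
    preimage last = a , sym (proj₁ (fibres _ _) La)
    surjective′ : Surjective _≡_ _≡_ (λ i → label (inject₁ i))
    surjective′ y with surjective y
    ... | x , h with preimage (lastView x)
    ... | x′ , e = x′ , λ { refl → trans e (h refl) }

  -- No other hexagon carries the label of the last one, so punching that label out
  -- relabels the remaining pieces by Fin k′.
  restrict-labelling-singleton : ∀ {k′} → k ≡ suc k′ → (∀ x → ¬ (inject₁ x ∼[ R ] fromℕ n)) →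
                                 Labelling n k′ (restrict R)
  restrict-labelling-singleton refl single =
    label′ , surjective′ ,
    λ i j → (λ p → punchOut-cong (label L) (proj₁ (fibres _ _) (⁻ refl refl p)))
          , (λ q → ⁺ refl refl (proj₂ (fibres _ _) (punchOut-injective (avoids i) (avoids j) q)))
    where
    L = fromℕ n
    avoids : ∀ x → label L ≢ label (inject₁ x)
    avoids x eq = single x (D.sym∼ L (inject₁ x) (proj₂ (fibres _ _) eq))
    label′ : Fin n → Fin _
    label′ x = punchOut (avoids x)
    preimage : ∀ {x} y → LastView x → label x ≡ punchIn (label L) y → Σ (Fin n) λ x′ → label′ x′ ≡ y
    preimage y (init x) e = x , trans (punchOut-cong (label L) e) (punchOut-punchIn (label L))
    preimage y last e = ⊥-elim (punchInᵢ≢i (label L) y (sym e))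
    surjective′ : Surjective _≡_ _≡_ label′
    surjective′ y with surjective (punchIn (label L) y)
    ... | x , h with preimage y (lastView x) (h refl)
    ... | x′ , e = x′ , λ { refl → e }

  last-piece-near : ∀ {x} → inject₁ x ∼[ R ] fromℕ n →
                    Σ (Fin n) λ y → Near y × inject₁ y ∼[ R ] fromℕ n
  last-piece-near {x} p with walk-last-step (D.connected (inject₁ x) (fromℕ n) p)
  ... | inj₁ eq = ⊥-elim (fromℕ≢inject₁ (sym eq))
  ... | inj₂ (u , pu , adj) = viewed (lastView u) pu adj
    where
    viewed : ∀ {u} → LastView u → inject₁ x ∼[ R ] u → Adj u (fromℕ n) →
             Σ (Fin n) λ y → Near y × inject₁ y ∼[ R ] fromℕ n
    viewed (init y) pu adj = y , adj-fromℕ⇒near adj , D.trans∼ _ _ _ (D.sym∼ _ _ pu) p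
    viewed last pu adj = ⊥-elim (adj-irrefl _ adj)

restrict-isDivision-joined : ∀ {n k} {R : Rel (suc n)} {a : Fin n} → IsDivision (suc n) k R → Near a →
                             fromℕ n ∼[ R ] inject₁ a → IsDivision n k (restrict R)
restrict-isDivision-joined d near La =
  pullback-isDivision inject₁ d (restrict-connected d near (λ x q → IsDivision.trans∼ d _ _ _ q La))
                      (restrict-labelling-joined d La)

restrict-isDivision-singleton : ∀ {m k} {R : Rel (suc (suc m))} → IsDivision (suc (suc m)) (suc k) R →
                                (∀ x → ¬ (inject₁ x ∼[ R ] fromℕ (suc m))) → IsDivision (suc m) k (restrict R)
restrict-isDivision-singleton {m} d single =
  pullback-isDivision inject₁ d (restrict-connected d (near-fromℕ m) (λ x q → ⊥-elim (single x q)))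
                      (restrict-labelling-singleton d refl single)

glue-joins : ∀ {n} (a : Fin n) (R : Rel n) → a ∼[ R ] a → inject₁ a ∼[ glue a R ] fromℕ n
glue-joins a R = pullback⁺ (collapse a) R (collapse-inject₁ a a) (collapse-fromℕ a)

singletonEntry : ∀ {n} → Rel n → {i j : Fin (suc n)} → LastView i → LastView j → Bool
singletonEntry R (init x) (init y) = entry R x y
singletonEntry R (init x) last = false
singletonEntry R last (init y) = false
singletonEntry R last last = true

adjoinSingleton : ∀ {n} → Rel n → Rel (suc n)
adjoinSingleton R = fromEntries λ i j → singletonEntry R (lastView i) (lastView j)

entry-adjoinSingleton : ∀ {n} (R : Rel n) i j →
                        entry (adjoinSingleton R) i j ≡ singletonEntry R (lastView i) (lastView j)
entry-adjoinSingleton R = entry-fromEntries (λ i j → singletonEntry R (lastView i) (lastView j))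

entry-adjoinSingleton-init : ∀ {n} (R : Rel n) x y →
                             entry (adjoinSingleton R) (inject₁ x) (inject₁ y) ≡ entry R x y
entry-adjoinSingleton-init R x y =
  trans (entry-adjoinSingleton R _ _) (cong₂ (singletonEntry R) (lastView-inject₁ x) (lastView-inject₁ y))

entry-adjoinSingleton-last : ∀ {n} (R : Rel n) x → entry (adjoinSingleton R) (inject₁ x) (fromℕ n) ≡ false
entry-adjoinSingleton-last {n} R x =
  trans (entry-adjoinSingleton R _ _) (cong₂ (singletonEntry R) (lastView-inject₁ x) (lastView-fromℕ n))

adjoinSingleton-isDivision : ∀ {n k} {R : Rel n} → IsDivision n k R → IsDivision (suc n) (suc k) (adjoinSingleton R)
adjoinSingleton-isDivision {n} {k} {R} d = record
  { refl∼ = λ i → ⁺ (refl′ (lastView i))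
  ; sym∼ = λ i j p → ⁺ (sym′ (lastView i) (lastView j) (⁻ p))
  ; trans∼ = λ i j l p q → ⁺ (trans′ (lastView i) (lastView j) (lastView l) (⁻ p) (⁻ q))
  ; connected = λ i j p → connected (lastView i) (lastView j) (⁻ p)
  ; numPieces = (λ i → label′ (lastView i)) , surjective′
              , λ i j → (λ p → proj₁ (fibres′ (lastView i) (lastView j)) (⁻ p))
                      , (λ q → ⁺ (proj₂ (fibres′ (lastView i) (lastView j)) q))
  }
  where
  module D = IsDivision d
  label = proj₁ D.numPieces
  fibres = proj₂ (proj₂ D.numPieces)
  _≈_ : ∀ {i j : Fin (suc n)} → LastView i → LastView j → Set
  u ≈ v = singletonEntry R u v ≡ true
  ⁺ : ∀ {i j} → lastView i ≈ lastView j → i ∼[ adjoinSingleton R ] j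
  ⁺ = trans (entry-adjoinSingleton R _ _)
  ⁻ : ∀ {i j} → i ∼[ adjoinSingleton R ] j → lastView i ≈ lastView j
  ⁻ = trans (sym (entry-adjoinSingleton R _ _))

  refl′ : ∀ {i} (u : LastView i) → u ≈ u
  refl′ (init x) = D.refl∼ x
  refl′ last = refl
  sym′ : ∀ {i j} (u : LastView i) (v : LastView j) → u ≈ v → v ≈ u
  sym′ (init x) (init y) p = D.sym∼ x y p
  sym′ last last p = p
  trans′ : ∀ {i j l} (u : LastView i) (v : LastView j) (w : LastView l) → u ≈ v → v ≈ w → u ≈ w
  trans′ (init x) (init y) (init z) p q = D.trans∼ x y z p q
  trans′ last last last p q = refl

  connected : ∀ {i j} (u : LastView i) (v : LastView j) → u ≈ v →
              WalkIn (λ l → i ∼[ adjoinSingleton R ] l) i j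
  connected (init x) (init y) p =
    walk-map inject₁-weakHom (λ q → trans (entry-adjoinSingleton-init R x _) q) (D.connected x y p)
  connected last last p = here (⁺ (subst (λ v → v ≈ v) (sym (lastView-fromℕ n)) refl))

  label′ : ∀ {i : Fin (suc n)} → LastView i → Fin (suc k)
  label′ (init x) = suc (label x)
  label′ last = zero
  fibres′ : ∀ {i j} (u : LastView i) (v : LastView j) →
            (u ≈ v → label′ u ≡ label′ v) × (label′ u ≡ label′ v → u ≈ v)
  fibres′ (init x) (init y) =
    (λ p → cong suc (proj₁ (fibres x y) p)) , (λ q → proj₂ (fibres x y) (Fin-suc-injective q))
  fibres′ (init x) last = (λ ()) , (λ ())
  fibres′ last (init y) = (λ ()) , (λ ())
  fibres′ last last = (λ _ → refl) , (λ _ → refl)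
  surjective′ : Surjective _≡_ _≡_ (λ i → label′ (lastView i))
  surjective′ zero = fromℕ n , λ { refl → cong label′ (lastView-fromℕ n) }
  surjective′ (suc y) with proj₁ (proj₂ D.numPieces) y
  ... | x , h = inject₁ x , λ { refl → trans (cong label′ (lastView-inject₁ x)) (cong suc (h refl)) }

restrict-glue : ∀ {n} (a : Fin n) (R : Rel n) → restrict (glue a R) ≡ R
restrict-glue a R = Rel-ext λ i j →
  trans (entry-pullback inject₁ (glue a R) i j)
        (trans (entry-pullback (collapse a) R _ _) (cong₂ (entry R) (collapse-inject₁ a i) (collapse-inject₁ a j)))

restrict-adjoinSingleton : ∀ {n} (R : Rel n) → restrict (adjoinSingleton R) ≡ R
restrict-adjoinSingleton R = Rel-ext λ i j →
  trans (entry-pullback inject₁ (adjoinSingleton R) i j) (entry-adjoinSingleton-init R i j)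

glue-restrict : ∀ {n k} {R : Rel (suc n)} {a : Fin n} → IsDivision (suc n) k R →
                fromℕ n ∼[ R ] inject₁ a → glue a (restrict R) ≡ R
glue-restrict {n} {R = R} {a} d La = Rel-ext λ i j →
  trans (entry-pullback (collapse a) (restrict R) i j)
        (trans (entry-pullback inject₁ R _ _)
               (bool-ext (λ p → D.trans∼ _ _ _ (D.sym∼ _ _ (moved i)) (D.trans∼ _ _ _ p (moved j)))
                          (λ p → D.trans∼ _ _ _ (moved i) (D.trans∼ _ _ _ p (D.sym∼ _ _ (moved j))))))
  where
  module D = IsDivision d
  viewed : ∀ {i} → LastView i → inject₁ (collapse a i) ∼[ R ] i
  viewed (init x) = subst (λ z → inject₁ z ∼[ R ] inject₁ x) (sym (collapse-inject₁ a x)) (D.refl∼ _)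
  viewed last = subst (λ z → inject₁ z ∼[ R ] fromℕ n) (sym (collapse-fromℕ a)) (D.sym∼ _ _ La)
  moved : ∀ i → inject₁ (collapse a i) ∼[ R ] i
  moved i = viewed (lastView i)

adjoinSingleton-restrict : ∀ {n k} {R : Rel (suc n)} → IsDivision (suc n) k R →
                           (∀ x → ¬ (inject₁ x ∼[ R ] fromℕ n)) → adjoinSingleton (restrict R) ≡ R
adjoinSingleton-restrict {n} {R = R} d single =
  Rel-ext λ i j → trans (entry-adjoinSingleton (restrict R) i j) (viewed (lastView i) (lastView j))
  where
  module D = IsDivision d
  viewed : ∀ {i j} → LastView i → LastView j →
           singletonEntry (restrict R) (lastView i) (lastView j) ≡ entry R i j
  viewed (init x) (init y) rewrite lastView-inject₁ x | lastView-inject₁ y = entry-pullback inject₁ R x y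
  viewed (init x) last rewrite lastView-inject₁ x | lastView-fromℕ n = sym (≢true⇒≡false (single x))
  viewed last (init y) rewrite lastView-inject₁ y | lastView-fromℕ n =
    sym (≢true⇒≡false (λ p → single y (D.sym∼ _ _ p)))
  viewed last last rewrite lastView-fromℕ n = sym (D.refl∼ _)

lastTwoJoined : ∀ {m} → Rel (suc (suc m)) → Bool
lastTwoJoined {m} R = entry R (inject₁ (fromℕ m)) (fromℕ (suc m))

lastTwoSplit⇒¬joined : ∀ {m} (R : Rel (suc (suc m))) → LastTwoSplit R → lastTwoJoined R ≡ false
lastTwoSplit⇒¬joined {m} R (i , j , i+1≡j , j+1≡n , i≁j)
  with toℕ-injective {i = j} {j = fromℕ (suc m)} (trans (suc-injective j+1≡n) (sym (toℕ-fromℕ (suc m))))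
... | refl with toℕ-injective {i = i} {j = inject₁ (fromℕ m)}
                  (trans (suc-injective (trans i+1≡j (toℕ-fromℕ (suc m))))
                         (sym (trans (toℕ-inject₁ (fromℕ m)) (toℕ-fromℕ m))))
... | refl = ≢true⇒≡false i≁j

¬joined⇒lastTwoSplit : ∀ {m} (R : Rel (suc (suc m))) → lastTwoJoined R ≡ false → LastTwoSplit R
¬joined⇒lastTwoSplit {m} R e =
  inject₁ (fromℕ m) , fromℕ (suc m)
  , trans (cong suc (trans (toℕ-inject₁ (fromℕ m)) (toℕ-fromℕ m))) (sym (toℕ-fromℕ (suc m)))
  , cong suc (toℕ-fromℕ (suc m))
  , λ p → false≢true (trans (sym e) p)

lastThirdJoined : ∀ {m} → Rel (suc (suc (suc m))) → Bool
lastThirdJoined {m} R = entry R (inject₁ (inject₁ (fromℕ m))) (fromℕ (suc (suc m)))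

module _ {m k} {R : Rel (suc (suc (suc m)))} (d : IsDivision _ k R) (s : LastTwoSplit R) where
  private
    module D = IsDivision d
    ¬joined = lastTwoSplit⇒¬joined R s

  lastThirdSplit⇒singleton : lastThirdJoined R ≡ false → ∀ x → ¬ (inject₁ x ∼[ R ] fromℕ (suc (suc m)))
  lastThirdSplit⇒singleton e x p with last-piece-near d p
  ... | y , near , q with near-cases near
  ... | inj₁ refl = false≢true (trans (sym ¬joined) q)
  ... | inj₂ refl = false≢true (trans (sym e) q)

  restrict-lastTwoSplit : lastThirdJoined R ≡ true → LastTwoSplit (restrict R)
  restrict-lastTwoSplit e = ¬joined⇒lastTwoSplit (restrict R) (≢true⇒≡false λ q →
    false≢true (trans (sym ¬joined) (D.trans∼ _ _ _ (D.sym∼ _ _ (pullback⁻ inject₁ R refl refl q)) e)))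

glue-lastTwoSplit : ∀ {m k} {R : Rel (suc (suc m))} → IsDivision _ k R → LastTwoSplit R →
                    LastTwoSplit (glue (inject₁ (fromℕ m)) R)
glue-lastTwoSplit {m} {R = R} d s = ¬joined⇒lastTwoSplit (glue a R) (≢true⇒≡false λ q →
  false≢true (trans (sym (lastTwoSplit⇒¬joined R s)) (IsDivision.sym∼ d _ _ (glued⁻ q))))
  where
  a = inject₁ (fromℕ m)
  glued⁻ : inject₁ (fromℕ (suc m)) ∼[ glue a R ] fromℕ (suc (suc m)) → fromℕ (suc m) ∼[ R ] a
  glued⁻ = pullback⁻ (collapse a) R {i = inject₁ (fromℕ (suc m))} {j = fromℕ (suc (suc m))}
                     (collapse-inject₁ a (fromℕ (suc m))) (collapse-fromℕ a)

division-≡ : ∀ {n k} {R S : Rel n} .{p : IsDivision n k R} .{q : IsDivision n k S} →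
             R ≡ S → division R p ≡ division S q
division-≡ refl = refl

splitDivision-≡ : ∀ {n k} {R S : Rel n} .{p : IsDivision n k R} .{q : IsDivision n k S}
                  .{s : LastTwoSplit R} .{t : LastTwoSplit S} → R ≡ S → splitDivision R p s ≡ splitDivision S q t
splitDivision-≡ refl = refl

-- The division proof is irrelevant, so the maps test the Boolean lastTwoJoined R and
-- remember the outcome as an equation; the inverse laws are then proved by matching on it.
division↔split⊎division : ∀ m k → Division (suc (suc m)) k ↔
                                  (SplitDivision (suc (suc m)) k ⊎ Division (suc m) k)
division↔split⊎division m k = mk↔ₛ′ to from to∘from from∘to
  where
  a = fromℕ m

  classify : (R : Rel (suc (suc m))) → .(IsDivision _ k R) → (b : Bool) → lastTwoJoined R ≡ b →
             SplitDivision (suc (suc m)) k ⊎ Division (suc m) k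
  classify R d true e =
    inj₂ (division (restrict R) (restrict-isDivision-joined d (near-fromℕ m) (IsDivision.sym∼ d _ _ e)))
  classify R d false e = inj₁ (splitDivision R d (¬joined⇒lastTwoSplit R e))

  to : Division (suc (suc m)) k → SplitDivision (suc (suc m)) k ⊎ Division (suc m) k
  to (division R d) = classify R d (lastTwoJoined R) refl

  from : SplitDivision (suc (suc m)) k ⊎ Division (suc m) k → Division (suc (suc m)) k
  from (inj₁ (splitDivision R d _)) = division R d
  from (inj₂ (division R d)) = division (glue a R) (glue-isDivision d (near-fromℕ m))

  classify-split : ∀ R .d .s b e → b ≡ false → classify R d b e ≡ inj₁ (splitDivision R d s)
  classify-split R d s false e refl = refl

  classify-glue : ∀ R .d .d′ b e → b ≡ true → classify (glue a R) d′ b e ≡ inj₂ (division R d)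
  classify-glue R d d′ true e refl = cong inj₂ (division-≡ (restrict-glue a R))

  from∘classify : ∀ R .d b e → from (classify R d b e) ≡ division R d
  from∘classify R d true e = division-≡ (recomputeᴿ (glue-restrict d (IsDivision.sym∼ d _ _ e)))
  from∘classify R d false e = refl

  to∘from : ∀ x → to (from x) ≡ x
  to∘from (inj₁ (splitDivision R d s)) =
    classify-split R d s _ refl (recomputeᵇ (lastTwoSplit⇒¬joined R s))
  to∘from (inj₂ (division R d)) =
    classify-glue R d _ _ refl (recomputeᵇ (glue-joins a R (IsDivision.refl∼ d a)))

  from∘to : ∀ x → from (to x) ≡ x
  from∘to (division R d) = from∘classify R d _ refl

split↔division⊎split : ∀ m k → SplitDivision (suc (suc (suc m))) (suc k) ↔
                               (Division (suc (suc m)) k ⊎ SplitDivision (suc (suc m)) (suc k))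
split↔division⊎split m k = mk↔ₛ′ to from to∘from from∘to
  where
  a = inject₁ (fromℕ m)

  classify : (R : Rel (suc (suc (suc m)))) → .(IsDivision _ (suc k) R) → .(LastTwoSplit R) → (b : Bool) →
             lastThirdJoined R ≡ b → Division (suc (suc m)) k ⊎ SplitDivision (suc (suc m)) (suc k)
  classify R d s true e = inj₂ (splitDivision (restrict R)
    (restrict-isDivision-joined d (near-inject₁-fromℕ m) (IsDivision.sym∼ d _ _ e)) (restrict-lastTwoSplit d s e))
  classify R d s false e =
    inj₁ (division (restrict R) (restrict-isDivision-singleton d (lastThirdSplit⇒singleton d s e)))

  to : SplitDivision (suc (suc (suc m))) (suc k) →
       Division (suc (suc m)) k ⊎ SplitDivision (suc (suc m)) (suc k)
  to (splitDivision R d s) = classify R d s (lastThirdJoined R) refl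

  from : Division (suc (suc m)) k ⊎ SplitDivision (suc (suc m)) (suc k) →
         SplitDivision (suc (suc (suc m))) (suc k)
  from (inj₁ (division R d)) = splitDivision (adjoinSingleton R) (adjoinSingleton-isDivision d)
    (¬joined⇒lastTwoSplit (adjoinSingleton R) (entry-adjoinSingleton-last R (fromℕ (suc m))))
  from (inj₂ (splitDivision R d s)) =
    splitDivision (glue a R) (glue-isDivision d (near-inject₁-fromℕ m)) (glue-lastTwoSplit d s)

  classify-singleton : ∀ R .d .d′ .s b e → b ≡ false →
                       classify (adjoinSingleton R) d′ s b e ≡ inj₁ (division R d)
  classify-singleton R d d′ s false e refl = cong inj₁ (division-≡ (restrict-adjoinSingleton R))

  classify-glue : ∀ R .d .s .d′ .s′ b e → b ≡ true →
                  classify (glue a R) d′ s′ b e ≡ inj₂ (splitDivision R d s)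
  classify-glue R d s d′ s′ true e refl = cong inj₂ (splitDivision-≡ (restrict-glue a R))

  from∘classify : ∀ R .d .s b e → from (classify R d s b e) ≡ splitDivision R d s
  from∘classify R d s true e = splitDivision-≡ (recomputeᴿ (glue-restrict d (IsDivision.sym∼ d _ _ e)))
  from∘classify R d s false e =
    splitDivision-≡ (recomputeᴿ (adjoinSingleton-restrict d (lastThirdSplit⇒singleton d s e)))

  to∘from : ∀ x → to (from x) ≡ x
  to∘from (inj₁ (division R d)) = classify-singleton R d _ _ _ refl (entry-adjoinSingleton-last R a)
  to∘from (inj₂ (splitDivision R d s)) =
    classify-glue R d s _ _ _ refl (recomputeᵇ (glue-joins a R (IsDivision.refl∼ d a)))

  from∘to : ∀ x → from (to x) ≡ x
  from∘to (splitDivision R d s) = from∘classify R d s _ refl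

split₂↔division₁ : ∀ k → SplitDivision 2 (suc k) ↔ Division 1 k
split₂↔division₁ k = mk↔ₛ′ to from
  (λ { (division R d) → division-≡ (restrict-adjoinSingleton R) })
  (λ { (splitDivision R d s) →
         splitDivision-≡ (recomputeᴿ (adjoinSingleton-restrict d (last-singleton R s))) })
  where
  last-singleton : (R : Rel 2) → LastTwoSplit R → ∀ x → ¬ (inject₁ x ∼[ R ] fromℕ 1)
  last-singleton R s zero q = false≢true (trans (sym (lastTwoSplit⇒¬joined R s)) q)

  to : SplitDivision 2 (suc k) → Division 1 k
  to (splitDivision R d s) = division (restrict R) (restrict-isDivision-singleton d (last-singleton R s))

  from : Division 1 k → SplitDivision 2 (suc k)
  from (division R d) = splitDivision (adjoinSingleton R) (adjoinSingleton-isDivision d)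
    (¬joined⇒lastTwoSplit (adjoinSingleton R) (entry-adjoinSingleton-last R zero))

no-division-into-zero : ∀ {n} → Division (suc n) 0 → ⊥
no-division-into-zero (division R d) = ⊥-elim-irr (noLabel (proj₁ (IsDivision.numPieces d) zero))
  where
  noLabel : Fin 0 → ⊥
  noLabel ()

no-split-of-one : ∀ {k} → SplitDivision 1 k → ⊥
no-split-of-one (splitDivision R d s) = ⊥-elim-irr (noSplit s)
  where
  noSplit : LastTwoSplit R → ⊥
  noSplit (zero , zero , () , _)

no-division-of-one-into-two : ∀ {k} → Division 1 (suc (suc k)) → ⊥
no-division-of-one-into-two (division R d) =
  ⊥-elim-irr (zero≢one (proj₁ (proj₂ (IsDivision.numPieces d))))
  where
  zero≢one : ∀ {label : Fin 1 → Fin (suc (suc _))} → Surjective _≡_ _≡_ label → ⊥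
  zero≢one surjective with surjective zero | surjective (suc zero)
  ... | zero , h | zero , h′ with trans (sym (h refl)) (h′ refl)
  ... | ()

division-of-one : Division 1 1 ↔ Fin 1
division-of-one = mk↔ₛ′ (λ _ → zero) (λ _ → whole) (λ { zero → refl }) unique
  where
  whole : Division 1 1
  whole = division ((true ∷ []) ∷ []) record
    { refl∼ = λ { zero → refl }
    ; sym∼ = λ { zero zero p → p }
    ; trans∼ = λ { zero zero zero p q → p }
    ; connected = λ { zero zero p → here p }
    ; numPieces = (λ _ → zero) , (λ { zero → zero , λ _ → refl })
                , λ { zero zero → (λ _ → refl) , (λ _ → refl) }
    }
  unique : ∀ x → whole ≡ x
  unique (division ((b ∷ []) ∷ []) d) =
    division-≡ (cong (λ c → (c ∷ []) ∷ []) (sym (recomputeᵇ (IsDivision.refl∼ d zero))))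

empty↔Fin0 : ∀ {A : Set} → (A → ⊥) → A ↔ Fin 0
empty↔Fin0 empty = mk↔ₛ′ (λ x → ⊥-elim (empty x)) (λ ()) (λ ()) (λ x → ⊥-elim (empty x))

sum↔ : ∀ {A B : Set} {a b} → A ↔ Fin a → B ↔ Fin b → (A ⊎ B) ↔ Fin (a + b)
sum↔ A↔a B↔b = ↔-trans (A↔a ⊎-↔ B↔b) (↔-sym +↔⊎)

-- divisionCount m k and splitCount m k are d_k(m+1) and s_k(m+1), defined by the recurrences
-- that the bijections above establish.
mutual
  divisionCount : ℕ → ℕ → ℕ
  divisionCount zero zero = 0
  divisionCount zero (suc zero) = 1
  divisionCount zero (suc (suc k)) = 0
  divisionCount (suc m) k = splitCount (suc m) k + divisionCount m k

  splitCount : ℕ → ℕ → ℕ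
  splitCount zero k = 0
  splitCount (suc m) zero = 0
  splitCount (suc m) (suc k) = divisionCount m k + splitCount m (suc k)

divisions↔divisionCount : ∀ m k → Division (suc m) k ↔ Fin (divisionCount m k)
splitDivisions↔splitCount : ∀ m k → SplitDivision (suc m) k ↔ Fin (splitCount m k)

divisions↔divisionCount zero zero = empty↔Fin0 no-division-into-zero
divisions↔divisionCount zero (suc zero) = division-of-one
divisions↔divisionCount zero (suc (suc k)) = empty↔Fin0 no-division-of-one-into-two
divisions↔divisionCount (suc m) k =
  ↔-trans (division↔split⊎division m k)
          (sum↔ (splitDivisions↔splitCount (suc m) k) (divisions↔divisionCount m k))

splitDivisions↔splitCount zero k = empty↔Fin0 no-split-of-one
splitDivisions↔splitCount (suc m) zero =
  empty↔Fin0 λ { (splitDivision R d s) → no-division-into-zero (division R d) }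
splitDivisions↔splitCount (suc zero) (suc k) =
  ↔-trans (split₂↔division₁ k)
          (subst (λ c → Division 1 k ↔ Fin c) (sym (+-identityʳ _)) (divisions↔divisionCount zero k))
splitDivisions↔splitCount (suc (suc m)) (suc k) =
  ↔-trans (split↔division⊎split m k)
          (sum↔ (divisions↔divisionCount (suc m) k) (splitDivisions↔splitCount (suc m) (suc k)))

binom-suc-suc : ∀ a n k → binom a (suc n) (suc k) ≡ binom a n k
binom-suc-suc a n zero = refl
binom-suc-suc a n (suc k) = refl

binom-pascal : ∀ a n k → binom a (suc n) k + binom a n k ≡ binom (suc a) (suc n) k
binom-pascal a n zero = trans (+-comm (a C suc n) (a C n)) (nCk+nC[k+1]≡[n+1]C[k+1] a n)
binom-pascal a zero (suc zero) = refl
binom-pascal a zero (suc (suc k)) = refl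
binom-pascal a (suc n) (suc k) = begin
  binom a (suc (suc n)) (suc k) + binom a (suc n) (suc k)
    ≡⟨ cong₂ _+_ (binom-suc-suc a (suc n) k) (binom-suc-suc a n k) ⟩
  binom a (suc n) k + binom a n k
    ≡⟨ binom-pascal a n k ⟩
  binom (suc a) (suc n) k
    ≡⟨ binom-suc-suc (suc a) (suc n) k ⟨
  binom (suc a) (suc (suc n)) (suc k) ∎
  where open ≡-Reasoning

divisionCount≡binom : ∀ m k → divisionCount m k ≡ binom (m + k ∸ 1) (suc m) k
splitCount≡binom : ∀ m k → splitCount (suc m) k ≡ binom (m + k ∸ 1) (suc (suc m)) k

divisionCount≡binom zero zero = refl
divisionCount≡binom zero (suc zero) = refl
divisionCount≡binom zero (suc (suc k)) = refl
divisionCount≡binom (suc m) k =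
  trans (cong₂ _+_ (splitCount≡binom m k) (divisionCount≡binom m k)) (pascal-pred m k)
  where
  pascal-pred : ∀ m k → binom (m + k ∸ 1) (suc (suc m)) k + binom (m + k ∸ 1) (suc m) k
                      ≡ binom (suc m + k ∸ 1) (suc (suc m)) k
  pascal-pred zero zero = refl
  pascal-pred zero (suc k) = binom-pascal k 1 (suc k)
  pascal-pred (suc m) k = binom-pascal (m + k) (suc (suc m)) k

splitCount≡binom m zero rewrite +-identityʳ m =
  sym (k>n⇒nCk≡0 (s≤s (≤-trans (m∸n≤m m 1) (n≤1+n m))))
splitCount≡binom zero (suc zero) = refl
splitCount≡binom zero (suc (suc zero)) = refl
splitCount≡binom zero (suc (suc (suc k))) = refl
splitCount≡binom (suc m) (suc k) = begin
  divisionCount (suc m) k + splitCount (suc m) (suc k)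
    ≡⟨ cong₂ _+_ (divisionCount≡binom (suc m) k) (splitCount≡binom m (suc k)) ⟩
  binom (m + k) (suc (suc m)) k + binom (m + suc k ∸ 1) (suc (suc m)) (suc k)
    ≡⟨ cong₂ _+_ (binom-suc-suc (m + k) (suc (suc m)) k)
                 (cong (λ a → binom (a ∸ 1) (suc (suc m)) (suc k)) (sym (+-suc m k))) ⟨
  binom (m + k) (suc (suc (suc m))) (suc k) + binom (m + k) (suc (suc m)) (suc k)
    ≡⟨ binom-pascal (m + k) (suc (suc m)) (suc k) ⟩
  binom (suc (m + k)) (suc (suc (suc m))) (suc k)
    ≡⟨ cong (λ a → binom a (suc (suc (suc m))) (suc k)) (+-suc m k) ⟨
  binom (m + suc k) (suc (suc (suc m))) (suc k) ∎
  where open ≡-Reasoning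

theorem9 : (n k : ℕ) → 1 ≤ n → 1 ≤ k →
             (Division n k ↔ Fin (binom (n + k ∸ 2) n k))
             × (n ≡ 1 → SplitDivision n k ↔ Fin 0)
             × (2 ≤ n → SplitDivision n k ↔ Fin (binom (n + k ∸ 3) n k))
theorem9 (suc m) k _ _ = divisions , lengthOne m , lengthTwoOrMore m
  where
  divisions : Division (suc m) k ↔ Fin (binom (m + k ∸ 1) (suc m) k)
  divisions = subst (λ c → Division (suc m) k ↔ Fin c) (divisionCount≡binom m k) (divisions↔divisionCount m k)

  lengthOne : ∀ m → suc m ≡ 1 → SplitDivision (suc m) k ↔ Fin 0
  lengthOne zero refl = splitDivisions↔splitCount zero k

  lengthTwoOrMore : ∀ m → 2 ≤ suc m → SplitDivision (suc m) k ↔ Fin (binom (suc m + k ∸ 3) (suc m) k)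
  lengthTwoOrMore zero (s≤s ())
  lengthTwoOrMore (suc m) _ =
    subst (λ c → SplitDivision (suc (suc m)) k ↔ Fin c) (splitCount≡binom m k)
          (splitDivisions↔splitCount (suc m) k)
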